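{- Define a sequence $(b_n)_{n\ge 0}$ of real numbers by $b_0=0$, $b_1=1$ and, for all $n\ge 0$, $$b_{3n}=b_n,\qquad b_{3n+1}=\sqrt2\, b_n+b_{n+1},\qquad b_{3n+2}=b_n+\sqrt2\, b_{n+1}.$$ For $n\ge 1$ let $s_n=\dfrac{\sqrt2\, b_{n+1}}{b_n}$. Then every positive rational number equals $s_n$ for some $n\ge 1$.
   Context: The sequence begins $b_0,b_1,b_2,\dots = 0,1,\sqrt2,1,2\sqrt2,3,\sqrt2,3,2\sqrt2,1,3\sqrt2,5,\dots$; all $b_n$ with $n\ge1$ are positive. -}

module Defs where

open import Data.Integer using (ℤ; +_) renaming (_+_ to _+ℤ_; _*_ to _*ℤ_)

-- The ring ℤ[√2]: the element  re + im·√2  (re, im integers).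
-- Since √2 is irrational, equality of such reals is componentwise,
-- so propositional equality of this record is equality in ℝ.
record ℤ[√2] : Set where
  constructor _+_√2
  field
    re : ℤ
    im : ℤ
open ℤ[√2] public

infixl 6 _⊕_
infixl 7 _⊗_ _·_

_⊕_ : ℤ[√2] → ℤ[√2] → ℤ[√2]
(a + b √2) ⊕ (c + d √2) = (a +ℤ c) + (b +ℤ d) √2

_⊗_ : ℤ[√2] → ℤ[√2] → ℤ[√2]
(a + b √2) ⊗ (c + d √2) = (a *ℤ c +ℤ (+ 2) *ℤ (b *ℤ d)) + (a *ℤ d +ℤ b *ℤ c) √2

ι : ℤ → ℤ[√2]
ι k = k + (+ 0) √2

_·_ : ℤ → ℤ[√2] → ℤ[√2]
k · x = ι k ⊗ x

√2 : ℤ[√2]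
√2 = (+ 0) + (+ 1) √2

𝟘 𝟙 : ℤ[√2]
𝟘 = ι (+ 0)
𝟙 = ι (+ 1)

{-# OPTIONS --safe #-}
-- Write s n for the slope √2 b (n + 1) / b n.  The recurrences give
--   s (3n) = s n + 2,   s (3n + 1) = 2 (1 + s n) / (2 + s n),   s (3n + 2) = s n / (1 + s n),
-- with s 1 = 2 and s 2 = 1.  A positive fraction p / r other than 1 and 2 is the image of a fraction
-- with smaller p + r under the last map if p < r, the middle one if r < p < 2r and the first if
-- p > 2r, so descending from p / r always ends at 1 or 2.
module Submission where

open import Defs
open import Data.Nat using (ℕ; zero; suc; _*_; _+_; _≥_; _<_; s≤s; z≤n; compare; less; equal; greater)
open import Data.Nat.Properties using (m≤m+n; ≤-trans; ≤-refl; *-identityʳ; +-assoc; *-distribˡ-+)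
open import Data.Nat.Tactic.RingSolver using (solve)
open import Data.Integer using (ℤ; +_; NonZero) renaming (_+_ to _+ℤ_; _*_ to _*ℤ_)
import Data.Integer.Properties as ℤ
open import Data.Rational using (ℚ; mkℚ; Positive; ↥_; ↧_)
open import Data.Product using (∃-syntax; _×_; _,_)
open import Data.List using (_∷_; [])
open import Data.Empty using (⊥-elim)
open import Relation.Binary.PropositionalEquality
open ≡-Reasoning

re-im-≡ : ∀ {x y : ℤ[√2]} → re x ≡ re y → im x ≡ im y → x ≡ y
re-im-≡ = cong₂ _+_√2

re-· : ∀ k x → re (k · x) ≡ k *ℤ re x
re-· k x = ℤ.+-identityʳ (k *ℤ re x)

im-· : ∀ k x → im (k · x) ≡ k *ℤ im x
im-· k x = ℤ.+-identityʳ (k *ℤ im x)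

re-√2⊗ : ∀ x → re (√2 ⊗ x) ≡ + 2 *ℤ im x
re-√2⊗ x = begin
  + 0 *ℤ re x +ℤ + 2 *ℤ (+ 1 *ℤ im x)  ≡⟨ ℤ.+-identityˡ _ ⟩
  + 2 *ℤ (+ 1 *ℤ im x)                  ≡⟨ cong (+ 2 *ℤ_) (ℤ.*-identityˡ (im x)) ⟩
  + 2 *ℤ im x                           ∎

im-√2⊗ : ∀ x → im (√2 ⊗ x) ≡ re x
im-√2⊗ x = trans (ℤ.+-identityˡ _) (ℤ.*-identityˡ (re x))

·-distribˡ-⊕ : ∀ k x y → k · (x ⊕ y) ≡ k · x ⊕ k · y
·-distribˡ-⊕ k x y = re-im-≡
  (trans (re-· k (x ⊕ y)) (trans (ℤ.*-distribˡ-+ k (re x) (re y)) (sym (cong₂ _+ℤ_ (re-· k x) (re-· k y)))))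
  (trans (im-· k (x ⊕ y)) (trans (ℤ.*-distribˡ-+ k (im x) (im y)) (sym (cong₂ _+ℤ_ (im-· k x) (im-· k y)))))

·-distribʳ-+ : ∀ k l x → (k +ℤ l) · x ≡ k · x ⊕ l · x
·-distribʳ-+ k l x = re-im-≡
  (trans (re-· (k +ℤ l) x) (trans (ℤ.*-distribʳ-+ (re x) k l) (sym (cong₂ _+ℤ_ (re-· k x) (re-· l x)))))
  (trans (im-· (k +ℤ l) x) (trans (ℤ.*-distribʳ-+ (im x) k l) (sym (cong₂ _+ℤ_ (im-· k x) (im-· l x)))))

·-assoc : ∀ k l x → k · (l · x) ≡ (k *ℤ l) · x
·-assoc k l x = re-im-≡
  (trans (re-· k (l · x)) (trans (cong (k *ℤ_) (re-· l x)) (trans (sym (ℤ.*-assoc k l (re x))) (sym (re-· (k *ℤ l) x)))))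
  (trans (im-· k (l · x)) (trans (cong (k *ℤ_) (im-· l x)) (trans (sym (ℤ.*-assoc k l (im x))) (sym (im-· (k *ℤ l) x)))))

·-comm : ∀ k l x → k · (l · x) ≡ l · (k · x)
·-comm k l x = trans (·-assoc k l x) (trans (cong (_· x) (ℤ.*-comm k l)) (sym (·-assoc l k x)))

·-cancelˡ : ∀ k {x y} .{{_ : NonZero k}} → k · x ≡ k · y → x ≡ y
·-cancelˡ k {x} {y} eq = re-im-≡
  (ℤ.*-cancelˡ-≡ k (re x) (re y) (trans (sym (re-· k x)) (trans (cong re eq) (re-· k y))))
  (ℤ.*-cancelˡ-≡ k (im x) (im y) (trans (sym (im-· k x)) (trans (cong im eq) (im-· k y))))

√2⊗-distrib-⊕ : ∀ x y → √2 ⊗ (x ⊕ y) ≡ √2 ⊗ x ⊕ √2 ⊗ y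
√2⊗-distrib-⊕ x y = re-im-≡
  (trans (re-√2⊗ (x ⊕ y)) (trans (ℤ.*-distribˡ-+ (+ 2) (im x) (im y)) (sym (cong₂ _+ℤ_ (re-√2⊗ x) (re-√2⊗ y)))))
  (trans (im-√2⊗ (x ⊕ y)) (sym (cong₂ _+ℤ_ (im-√2⊗ x) (im-√2⊗ y))))

√2⊗-· : ∀ k x → √2 ⊗ (k · x) ≡ k · (√2 ⊗ x)
√2⊗-· k x = re-im-≡
  (begin
    re (√2 ⊗ (k · x))     ≡⟨ re-√2⊗ (k · x) ⟩
    + 2 *ℤ im (k · x)     ≡⟨ cong (+ 2 *ℤ_) (im-· k x) ⟩
    + 2 *ℤ (k *ℤ im x)    ≡⟨ ℤ.*-assoc (+ 2) k (im x) ⟨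
    + 2 *ℤ k *ℤ im x      ≡⟨ cong (_*ℤ im x) (ℤ.*-comm (+ 2) k) ⟩
    k *ℤ + 2 *ℤ im x      ≡⟨ ℤ.*-assoc k (+ 2) (im x) ⟩
    k *ℤ (+ 2 *ℤ im x)    ≡⟨ cong (k *ℤ_) (re-√2⊗ x) ⟨
    k *ℤ re (√2 ⊗ x)      ≡⟨ re-· k (√2 ⊗ x) ⟨
    re (k · (√2 ⊗ x))     ∎)
  (trans (im-√2⊗ (k · x)) (trans (re-· k x) (trans (cong (k *ℤ_) (sym (im-√2⊗ x))) (sym (im-· k (√2 ⊗ x))))))

√2⊗√2⊗ : ∀ x → √2 ⊗ (√2 ⊗ x) ≡ + 2 · x
√2⊗√2⊗ x = re-im-≡
  (trans (re-√2⊗ (√2 ⊗ x)) (trans (cong (+ 2 *ℤ_) (im-√2⊗ x)) (sym (re-· (+ 2) x))))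
  (trans (im-√2⊗ (√2 ⊗ x)) (trans (re-√2⊗ x) (sym (im-· (+ 2) x))))

√2⊗-injective : ∀ {x y} → √2 ⊗ x ≡ √2 ⊗ y → x ≡ y
√2⊗-injective {x} {y} eq = ·-cancelˡ (+ 2) (trans (sym (√2⊗√2⊗ x)) (trans (cong (√2 ⊗_) eq) (√2⊗√2⊗ y)))

·-zeroʳ : ∀ k → k · 𝟘 ≡ 𝟘
·-zeroʳ k = re-im-≡ (trans (re-· k 𝟘) (ℤ.*-zeroʳ k)) (trans (im-· k 𝟘) (ℤ.*-zeroʳ k))

⊕-of-multiples : ∀ k x y r p w → k · x ≡ r · w → k · y ≡ p · w → k · (x ⊕ y) ≡ (r +ℤ p) · w
⊕-of-multiples k x y r p w kx≡rw ky≡pw = begin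
  k · (x ⊕ y)       ≡⟨ ·-distribˡ-⊕ k x y ⟩
  k · x ⊕ k · y     ≡⟨ cong₂ _⊕_ kx≡rw ky≡pw ⟩
  r · w ⊕ p · w     ≡⟨ ·-distribʳ-+ r p w ⟨
  (r +ℤ p) · w      ∎

√2⊗-of-multiple : ∀ k x r w → k · x ≡ r · w → k · (√2 ⊗ x) ≡ r · (√2 ⊗ w)
√2⊗-of-multiple k x r w kx≡rw = begin
  k · (√2 ⊗ x)     ≡⟨ √2⊗-· k x ⟨
  √2 ⊗ (k · x)     ≡⟨ cong (√2 ⊗_) kx≡rw ⟩
  √2 ⊗ (r · w)     ≡⟨ √2⊗-· r w ⟩
  r · (√2 ⊗ w)     ∎

·-of-multiple : ∀ m k x r w → k · x ≡ r · w → (m *ℤ k) · x ≡ (m *ℤ r) · w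
·-of-multiple m k x r w kx≡rw = begin
  (m *ℤ k) · x     ≡⟨ ·-assoc m k x ⟨
  m · (k · x)      ≡⟨ cong (m ·_) kx≡rw ⟩
  m · (r · w)      ≡⟨ ·-assoc m r w ⟩
  (m *ℤ r) · w     ∎

cross-multiply : ∀ k x y r p w .{{_ : NonZero k}} → k · x ≡ r · w → k · y ≡ p · w → r · y ≡ p · x
cross-multiply k x y r p w kx≡rw ky≡pw = ·-cancelˡ k (begin
  k · (r · y)      ≡⟨ ·-comm k r y ⟩
  r · (k · y)      ≡⟨ cong (r ·_) ky≡pw ⟩
  r · (p · w)      ≡⟨ ·-comm r p w ⟩
  p · (r · w)      ≡⟨ cong (p ·_) kx≡rw ⟨
  p · (k · x)      ≡⟨ ·-comm p k x ⟩
  k · (p · x)      ∎)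

multiple-≢𝟘 : ∀ k x r w .{{_ : NonZero r}} → k · x ≡ r · w → w ≢ 𝟘 → x ≢ 𝟘
multiple-≢𝟘 k x r w kx≡rw w≢𝟘 x≡𝟘 = w≢𝟘 (·-cancelˡ r (begin
  r · w            ≡⟨ kx≡rw ⟨
  k · x            ≡⟨ cong (k ·_) x≡𝟘 ⟩
  k · 𝟘            ≡⟨ ·-zeroʳ k ⟩
  𝟘                ≡⟨ ·-zeroʳ r ⟨
  r · 𝟘            ∎))

<-bound-of-+ : ∀ {s f} a t → s < suc f → suc (a + t) ≡ s → a < f
<-bound-of-+ a t (s≤s s≤f) refl = ≤-trans (s≤s (m≤m+n a t)) s≤f

module Sequence (b : ℕ → ℤ[√2]) (b₀ : b 0 ≡ 𝟘) (b₁ : b 1 ≡ 𝟙)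
                (b₃ₙ : ∀ n → b (3 * n) ≡ b n)
                (b₃ₙ₊₁ : ∀ n → b (3 * n + 1) ≡ √2 ⊗ b n ⊕ b (n + 1))
                (b₃ₙ₊₂ : ∀ n → b (3 * n + 2) ≡ b n ⊕ √2 ⊗ b (n + 1)) where

  -- (b n , √2 b (n + 1)) is a nonzero multiple of (r , p) over ℚ(√2), so s_n = p / r.
  record RatioAt (n p r : ℕ) : Set where
    constructor ratio
    field
      scale  : ℕ
      w      : ℤ[√2]
      w≢𝟘    : w ≢ 𝟘
      at-n   : + suc scale · b n ≡ + r · w
      at-suc : + suc scale · (√2 ⊗ b (n + 1)) ≡ + p · w

  b₂ : b 2 ≡ √2
  b₂ = trans (b₃ₙ₊₂ 0) (cong₂ (λ x y → x ⊕ √2 ⊗ y) b₀ b₁)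

  ratio-at-1 : RatioAt 1 2 1
  ratio-at-1 = ratio 0 𝟙 (λ ()) (cong (+ 1 ·_) b₁) (cong (λ x → + 1 · (√2 ⊗ x)) b₂)

  ratio-at-2 : RatioAt 2 1 1
  ratio-at-2 = ratio 0 √2 (λ ()) (cong (+ 1 ·_) b₂) (cong (λ x → + 1 · (√2 ⊗ x)) (trans (b₃ₙ 1) b₁))

  ratio-scale : ∀ m {n p r} → RatioAt n p r → RatioAt n (suc m * p) (suc m * r)
  ratio-scale m {n} {p} {r} (ratio s w w≢𝟘 at-n at-suc) =
    ratio (s + m * suc s) w w≢𝟘 (rescale (b n) r at-n) (rescale (√2 ⊗ b (n + 1)) p at-suc)
    where
    rescale : ∀ x q → + suc s · x ≡ + q · w → + (suc m * suc s) · x ≡ + (suc m * q) · w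
    rescale x q eq = begin
      + (suc m * suc s) · x        ≡⟨ cong (_· x) (ℤ.pos-* (suc m) (suc s)) ⟩
      (+ suc m *ℤ + suc s) · x     ≡⟨ ·-of-multiple (+ suc m) (+ suc s) x (+ q) w eq ⟩
      (+ suc m *ℤ + q) · w         ≡⟨ cong (_· w) (ℤ.pos-* (suc m) q) ⟨
      + (suc m * q) · w            ∎

  ratio-3n : ∀ {n p r} → RatioAt n p r → RatioAt (3 * n) (2 * r + p) r
  ratio-3n {n} {p} {r} (ratio s w w≢𝟘 at-n at-suc) =
    ratio s w w≢𝟘 (trans (cong (k ·_) (b₃ₙ n)) at-n) (begin
      k · (√2 ⊗ b (3 * n + 1))                  ≡⟨ cong (λ x → k · (√2 ⊗ x)) (b₃ₙ₊₁ n) ⟩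
      k · (√2 ⊗ (√2 ⊗ b n ⊕ b (n + 1)))         ≡⟨ cong (k ·_) (√2⊗-distrib-⊕ (√2 ⊗ b n) (b (n + 1))) ⟩
      k · (√2 ⊗ (√2 ⊗ b n) ⊕ √2 ⊗ b (n + 1))    ≡⟨ ⊕-of-multiples k (√2 ⊗ (√2 ⊗ b n)) (√2 ⊗ b (n + 1))
                                                                    (+ 2 *ℤ + r) (+ p) w at-2n at-suc ⟩
      (+ 2 *ℤ + r +ℤ + p) · w                   ≡⟨ cong (λ c → (c +ℤ + p) · w) (ℤ.pos-* 2 r) ⟨
      + (2 * r + p) · w                         ∎)
    where
    k : ℤ
    k = + suc s
    at-2n : k · (√2 ⊗ (√2 ⊗ b n)) ≡ (+ 2 *ℤ + r) · w
    at-2n = begin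
      k · (√2 ⊗ (√2 ⊗ b n))   ≡⟨ cong (k ·_) (√2⊗√2⊗ (b n)) ⟩
      k · (+ 2 · b n)         ≡⟨ ·-comm k (+ 2) (b n) ⟩
      + 2 · (k · b n)         ≡⟨ cong (+ 2 ·_) at-n ⟩
      + 2 · (+ r · w)         ≡⟨ ·-assoc (+ 2) (+ r) w ⟩
      (+ 2 *ℤ + r) · w        ∎

  ratio-3n+2 : ∀ {n p r} → RatioAt n p r → RatioAt (3 * n + 2) p (r + p)
  ratio-3n+2 {n} {p} {r} (ratio s w w≢𝟘 at-n at-suc) =
    ratio s w w≢𝟘
      (trans (cong (+ suc s ·_) (b₃ₙ₊₂ n))
             (⊕-of-multiples (+ suc s) (b n) (√2 ⊗ b (n + 1)) (+ r) (+ p) w at-n at-suc))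
      (trans (cong (λ x → + suc s · (√2 ⊗ x)) b₃₍ₙ₊₁₎) at-suc)
    where
    b₃₍ₙ₊₁₎ : b (3 * n + 2 + 1) ≡ b (n + 1)
    b₃₍ₙ₊₁₎ = trans (cong b (trans (+-assoc (3 * n) 2 1) (sym (*-distribˡ-+ 3 n 1)))) (b₃ₙ (n + 1))

  ratio-3n+1 : ∀ {n u r} → RatioAt n (2 * u) r → RatioAt (3 * n + 1) (r + 2 * u) (r + u)
  ratio-3n+1 {n} {u} {r} (ratio s w w≢𝟘 at-n at-suc) =
    ratio s (√2 ⊗ w) (λ √2w≡𝟘 → w≢𝟘 (√2⊗-injective √2w≡𝟘))
      (trans (cong (k ·_) (b₃ₙ₊₁ n))
             (⊕-of-multiples k (√2 ⊗ b n) (b (n + 1)) (+ r) (+ u) (√2 ⊗ w) (√2⊗-of-multiple k (b n) (+ r) w at-n) at-n+1))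
      (begin
        k · (√2 ⊗ b (3 * n + 1 + 1))                  ≡⟨ cong (λ x → k · (√2 ⊗ x)) (trans (cong b (+-assoc (3 * n) 1 1)) (b₃ₙ₊₂ n)) ⟩
        k · (√2 ⊗ (b n ⊕ √2 ⊗ b (n + 1)))             ≡⟨ cong (k ·_) (√2⊗-distrib-⊕ (b n) (√2 ⊗ b (n + 1))) ⟩
        k · (√2 ⊗ b n ⊕ √2 ⊗ (√2 ⊗ b (n + 1)))        ≡⟨ ⊕-of-multiples k (√2 ⊗ b n) (√2 ⊗ (√2 ⊗ b (n + 1))) (+ r) (+ (2 * u)) (√2 ⊗ w)
                                                             (√2⊗-of-multiple k (b n) (+ r) w at-n)
                                                             (√2⊗-of-multiple k (√2 ⊗ b (n + 1)) (+ (2 * u)) w at-suc) ⟩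
        + (r + 2 * u) · (√2 ⊗ w)                      ∎)
    where
    k : ℤ
    k = + suc s
    at-n+1 : k · b (n + 1) ≡ + u · (√2 ⊗ w)
    at-n+1 = √2⊗-injective (begin
      √2 ⊗ (k · b (n + 1))        ≡⟨ √2⊗-· k (b (n + 1)) ⟩
      k · (√2 ⊗ b (n + 1))        ≡⟨ at-suc ⟩
      + (2 * u) · w               ≡⟨ cong (_· w) (ℤ.pos-* 2 u) ⟩
      (+ 2 *ℤ + u) · w            ≡⟨ ·-assoc (+ 2) (+ u) w ⟨
      + 2 · (+ u · w)             ≡⟨ ·-comm (+ 2) (+ u) w ⟩
      + u · (+ 2 · w)             ≡⟨ cong (+ u ·_) (√2⊗√2⊗ w) ⟨
      + u · (√2 ⊗ (√2 ⊗ w))       ≡⟨ √2⊗-· (+ u) (√2 ⊗ w) ⟨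
      √2 ⊗ (+ u · (√2 ⊗ w))       ∎)

  slope : ∀ {n p r} → RatioAt n (suc p) (suc r) → b n ≢ 𝟘 × + suc r · (√2 ⊗ b (n + 1)) ≡ + suc p · b n
  slope {n} {p} {r} (ratio s w w≢𝟘 at-n at-suc) =
    multiple-≢𝟘 (+ suc s) (b n) (+ suc r) w at-n w≢𝟘 ,
    cross-multiply (+ suc s) (b n) (√2 ⊗ b (n + 1)) (+ suc r) (+ suc p) w at-n at-suc

  index-positive : ∀ {n} → b n ≢ 𝟘 → n ≥ 1
  index-positive {zero}  b₀≢𝟘 = ⊥-elim (b₀≢𝟘 b₀)
  index-positive {suc n} _    = s≤s z≤n

  ratio-resp : ∀ {n p r p′ r′} → RatioAt n p r → p ≡ p′ → r ≡ r′ → RatioAt n p′ r′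
  ratio-resp ρ refl refl = ρ

  every-ratio : ∀ f p r → p + r < f → ∃[ n ] RatioAt n (suc p) (suc r)
  every-ratio zero p r ()
  every-ratio (suc f) p r bound with compare p r
  ... | equal _ = 2 , ratio-resp (ratio-scale p ratio-at-2) (*-identityʳ (suc p)) (*-identityʳ (suc p))
  ... | less _ m =
    let n , ρ = every-ratio f p m (<-bound-of-+ (p + m) p bound (solve (p ∷ m ∷ [])))
    in 3 * n + 2 , ratio-resp (ratio-3n+2 ρ) refl (solve (p ∷ m ∷ []))
  every-ratio (suc f) _ r bound | greater _ k with compare k r
  ... | equal _ = 1 , ratio-resp (ratio-scale r ratio-at-1) (solve (r ∷ [])) (*-identityʳ (suc r))
  ... | less _ j =
    -- k + suc (k + 0) is 2 * suc k minus one.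
    let n , ρ = every-ratio f (k + suc (k + 0)) j (<-bound-of-+ (k + suc (k + 0) + j) (suc (k + j)) bound (solve (k ∷ j ∷ [])))
    in 3 * n + 1 , ratio-resp (ratio-3n+1 {u = suc k} ρ) (solve (k ∷ j ∷ [])) (solve (k ∷ j ∷ []))
  ... | greater _ j =
    let n , ρ = every-ratio f j r (<-bound-of-+ (j + r) (suc (r + r)) bound (solve (r ∷ j ∷ [])))
    in 3 * n , ratio-resp (ratio-3n ρ) (solve (r ∷ j ∷ [])) refl

theorem2 : (b : ℕ → ℤ[√2]) →
           b 0 ≡ 𝟘 → b 1 ≡ 𝟙 →
           (∀ n → b (3 * n) ≡ b n) →
           (∀ n → b (3 * n + 1) ≡ √2 ⊗ b n ⊕ b (n + 1)) →
           (∀ n → b (3 * n + 2) ≡ b n ⊕ √2 ⊗ b (n + 1)) →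
           (q : ℚ) → Positive q →
           ∃[ n ] (n ≥ 1 × b n ≢ 𝟘 × (↧ q) · (√2 ⊗ b (n + 1)) ≡ (↥ q) · b n)
theorem2 b b₀ b₁ b₃ₙ b₃ₙ₊₁ b₃ₙ₊₂ (mkℚ (+ suc p) r _) _ =
  let n , ρ = every-ratio (suc (p + r)) p r ≤-refl
      b≢𝟘 , s≡p/r = slope ρ
  in n , index-positive b≢𝟘 , b≢𝟘 , s≡p/r
  where open Sequence b b₀ b₁ b₃ₙ b₃ₙ₊₁ b₃ₙ₊₂
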